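{- For every fixed choice of the bad-partition parameter $p\in(0,1)$, pdqsort (as described in the context) has worst-case running time $O(n\log n)$ on arrays of length $n$.
   Context: Setting. The input is an array $A[0..n-1]$ ($n\ge 1$) of elements compared by a strict weak ordering $<$. Two elements $a,b$ compare equal if neither $a<b$ nor $b<a$; $a\le b$ means "not $b<a$". Running time counts elementary operations, each comparison or element move costing $O(1)$. Pattern-defeating quicksort (pdqsort) has fixed constants: an insertion-sort threshold $c\ge 3$, a bad-partition parameter $p\in(0,1)$ (the reference implementation uses $p=1/8$), and a constant bound on element moves for a partial insertion sort. It is the following recursive procedure acting in place on contiguous subarrays $A[a..b)=(A[a],\dots,A[b-1])$, each call carrying an integer counter $t$; the top-level call is on $A[0..n)$ with $t=\lfloor\log_2 n\rfloor$. A subarray $A[a..b)$ is leftmost if $a=0$; otherwise its predecessor is the element currently at position $a-1$. A call on $A[a..b)$ with $m=b-a$ and counter $t$ does: (1) if $m\le c$, sort $A[a..b)$ by insertion sort and return; (2) if $t=0$, sort $A[a..b)$ by heapsort and return; (3) select a pivot $q$ from $A[a..b)$ as the median of at least three sampled elements of $A[a..b)$ by a deterministic rule using $O(1)$ comparisons, and move it to position $a$; (4) if $a>0$ and the predecessor compares equal to $q$, apply partition_left: in $O(m)$ time rearrange $A[a..b)$ so that $q$ ends at a position $r$, every element of $A[a..r)$ is $\le q$ and every element of $A[r+1..b)$ is $>q$. Otherwise apply partition_right: in $O(m)$ time rearrange so that $q$ ends at a position $r$, every element of $A[a..r)$ is $<q$ and every element of $A[r+1..b)$ is $\ge q$; (5)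 the partition is bad if $\min(r-a,\,b-r-1)<p\,m$, and good otherwise; if it is bad, set $t:=t-1$ and swap $O(1)$ elements at fixed relative positions inside each of the two parts; (6) if partition_right was applied, the partition is good, and the partition step moved no element other than the pivot, run on each of $A[a..r)$ and $A[r+1..b)$ an insertion sort that aborts after the constant number of element moves; if both complete, return; (7) if partition_left was applied, recurse only on $A[r+1..b)$ with counter $t$; otherwise recurse on $A[a..r)$ and then on $A[r+1..b)$, each with counter $t$. The counter is local to each call (decrements in one subtree do not affect other subtrees). -}

module Defs where

open import Level using (Level; _⊔_) renaming (suc to lsuc)
open import Data.Bool using (Bool; true; false; _∧_; not; if_then_else_)
open import Data.Nat using (ℕ; zero; suc; _+_; _*_; _≤_; _<_; _⊓_)
open import Data.Nat.Logarithm using (⌊log₂_⌋)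
open import Data.Integer using (+_)
open import Data.Rational using (ℚ; 0ℚ; 1ℚ; _/_)
import Data.Rational as ℚ
open import Data.Product using (_×_; _,_; ∃; ∃₂; Σ)
open import Data.Sum using (_⊎_)
open import Data.Maybe using (Maybe; just; nothing)
open import Data.List using (List; []; _∷_; _++_; length; filter)
open import Data.List.Relation.Unary.All using (All)
open import Data.List.Relation.Unary.Linked using (Linked)
open import Data.List.Membership.Propositional using (_∈_)
open import Data.List.Relation.Binary.Permutation.Propositional using (_↭_)
open import Data.List.Relation.Binary.Sublist.Propositional using (_⊆_)
open import Relation.Binary.Core using (Rel)
open import Relation.Binary.Definitions using (Decidable)
open import Relation.Binary.PropositionalEquality using (_≡_)
open import Relation.Nullary using (¬_)

record IsStrictWeakOrder {a ℓ} {A : Set a} (_≺_ : Rel A ℓ) : Set (a ⊔ ℓ) where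
  field
    irrefl    : ∀ {x} → ¬ (x ≺ x)
    trans     : ∀ {x y z} → x ≺ y → y ≺ z → x ≺ z
    incomp-trans : ∀ {x y z} → (¬ x ≺ y × ¬ y ≺ x) → (¬ y ≺ z × ¬ z ≺ y)
                 → (¬ x ≺ z × ¬ z ≺ x)

-- A real number p with 0 < p < 1, given (as the algorithm only ever
-- compares p with rationals) by its decidable lower Dedekind cut
-- below q = true  iff  q < p.

record RealIn01 : Set where
  field
    below     : ℚ → Bool
    downward  : ∀ {q r} → r ℚ.< q → below q ≡ true → below r ≡ true
    rounded   : ∀ {q} → below q ≡ true → ∃ λ r → q ℚ.< r × below r ≡ true
    positive  : ∃ λ q → 0ℚ ℚ.< q × below q ≡ true
    lessThan1 : ∃ λ q → q ℚ.< 1ℚ × below q ≡ false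

-- the test  k < p * m  (for m = 0 it is false, as k < 0 is false)
lessThanPTimes : RealIn01 → ℕ → ℕ → Bool
lessThanPTimes p k zero    = false
lessThanPTimes p k (suc m) = RealIn01.below p ((+ k) / suc m)

-- An instantiation of pdqsort: the element type with its ordering, the
-- fixed constants c, p, K, and the subroutines the description leaves
-- abstract, together with their specifications.  Each subroutine returns
-- its result together with its cost (number of comparisons and element
-- moves it performs); the cost bounds use a single machine constant κ.

record PDQ (a ℓ : Level) : Set (lsuc (a ⊔ ℓ)) where
  field
    Elem    : Set a
    _≺_     : Rel Elem ℓ
    isSWO   : IsStrictWeakOrder _≺_
    _≺?_    : Decidable _≺_

  _≼_ : Elem → Elem → Set ℓ
  x ≼ y = ¬ (y ≺ x)

  Sorted : List Elem → Set (a ⊔ ℓ)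
  Sorted = Linked _≼_

  IsMedianOf : Elem → List Elem → Set a
  IsMedianOf q S = q ∈ S
                 × 2 * length (filter (λ s → s ≺? q) S) ≤ length S
                 × 2 * length (filter (λ s → q ≺? s) S) ≤ length S

  field
    c       : ℕ               -- insertion-sort threshold
    3≤c     : 3 ≤ c
    p       : RealIn01        -- bad-partition parameter, 0 < p < 1
    K       : ℕ               -- move bound of the partial insertion sort
    κ       : ℕ

    insertionSort      : List Elem → List Elem × ℕ
    insertionSort-perm : ∀ xs → Data.Product.proj₁ (insertionSort xs) ↭ xs
    insertionSort-sort : ∀ xs → Sorted (Data.Product.proj₁ (insertionSort xs))
    insertionSort-cost : ∀ xs → Data.Product.proj₂ (insertionSort xs)
                                  ≤ κ * (length xs * length xs + 1)

    heapSort      : List Elem → List Elem × ℕ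
    heapSort-perm : ∀ xs → Data.Product.proj₁ (heapSort xs) ↭ xs
    heapSort-sort : ∀ xs → Sorted (Data.Product.proj₁ (heapSort xs))
    heapSort-cost : ∀ xs → Data.Product.proj₂ (heapSort xs)
                             ≤ κ * (length xs * (⌊log₂ length xs ⌋ + 1) + 1)

    -- pivot selection on a nonempty subarray x ∷ xs: returns the pivot q
    -- (now at the first position), the remaining elements, and the cost
    selectPivot : Elem → List Elem → Elem × List Elem × ℕ
    selectPivot-perm : ∀ x xs → let (q , rest , _) = selectPivot x xs in
                         (q ∷ rest) ↭ (x ∷ xs)
    selectPivot-median : ∀ x xs → 3 ≤ length (x ∷ xs) →
                         let (q , _ , _) = selectPivot x xs in
                         ∃ λ S → S ⊆ (x ∷ xs) × 3 ≤ length S × IsMedianOf q S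
    selectPivot-cost : ∀ x xs → let (_ , _ , k) = selectPivot x xs in k ≤ κ

    -- partition_right q rest = (L , R , noMoves , cost): the subarray
    -- becomes L ++ q ∷ R; noMoves reports whether the partition step moved
    -- no element other than the pivot
    partitionRight : Elem → List Elem → List Elem × List Elem × Bool × ℕ
    partitionRight-perm : ∀ q ys → let (L , R , _ , _) = partitionRight q ys in
                            (L ++ R) ↭ ys
    partitionRight-left  : ∀ q ys → let (L , _ , _ , _) = partitionRight q ys in
                            All (_≺ q) L
    partitionRight-right : ∀ q ys → let (_ , R , _ , _) = partitionRight q ys in
                            All (q ≼_) R
    partitionRight-cost  : ∀ q ys → let (_ , _ , _ , k) = partitionRight q ys in
                            k ≤ κ * (length ys + 1)

    -- partition_left q rest = (L , R , cost): the subarray becomes L ++ q ∷ R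
    partitionLeft : Elem → List Elem → List Elem × List Elem × ℕ
    partitionLeft-perm : ∀ q ys → let (L , R , _) = partitionLeft q ys in
                           (L ++ R) ↭ ys
    partitionLeft-left  : ∀ q ys → let (L , _ , _) = partitionLeft q ys in
                           All (_≼ q) L
    partitionLeft-right : ∀ q ys → let (_ , R , _) = partitionLeft q ys in
                           All (q ≺_) R
    partitionLeft-cost  : ∀ q ys → let (_ , _ , k) = partitionLeft q ys in
                           k ≤ κ * (length ys + 1)

    -- the O(1) swaps performed inside a part after a bad partition
    badSwap      : List Elem → List Elem × ℕ
    badSwap-perm : ∀ xs → Data.Product.proj₁ (badSwap xs) ↭ xs
    badSwap-cost : ∀ xs → Data.Product.proj₂ (badSwap xs) ≤ κ

    -- insertion sort aborting after K element moves:
    -- (result , completed? , cost)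
    partialInsertionSort : List Elem → List Elem × Bool × ℕ
    partialInsertionSort-perm : ∀ xs → let (ys , _ , _) = partialInsertionSort xs in
                                  ys ↭ xs
    partialInsertionSort-sort : ∀ xs → let (ys , ok , _) = partialInsertionSort xs in
                                  ok ≡ true → Sorted ys
    partialInsertionSort-cost : ∀ xs → let (_ , _ , k) = partialInsertionSort xs in
                                  k ≤ κ * (length xs + K + 1)

-- The algorithm, as a big-step cost semantics.
--   Run P t pred xs ys k : the call on subarray xs, with counter t and
--   predecessor pred (nothing = leftmost), leaves ys in place of xs and
--   costs k elementary operations.  Each call is charged 1 for its own
--   O(1) bookkeeping, plus the costs of the subroutines it invokes.

data Kind : Set where
  left right : Kind

module Algorithm {a ℓ} (P : PDQ a ℓ) where
  open PDQ P

  Equiv : Elem → Elem → Set ℓ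
  Equiv x y = ¬ x ≺ y × ¬ y ≺ x

  data KindOf : Maybe Elem → Elem → Kind → Set (a ⊔ ℓ) where
    usesLeft  : ∀ {b q} → Equiv b q → KindOf (just b) q left
    usesRight : ∀ {pr q} → (∀ b → pr ≡ just b → ¬ Equiv b q) → KindOf pr q right

  partitionBy : Kind → Elem → List Elem → List Elem × List Elem × Bool × ℕ
  partitionBy left  q ys = let (L , R , k) = partitionLeft q ys in (L , R , false , k)
  partitionBy right q ys = partitionRight q ys

  isRight : Kind → Bool
  isRight left  = false
  isRight right = true

  -- step (5): counter for the children, the two parts, and the cost
  afterCheck : Bool → ℕ → List Elem → List Elem → ℕ × List Elem × List Elem × ℕ
  afterCheck true  t L R = let (L′ , k₁) = badSwap L ; (R′ , k₂) = badSwap R in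
                           (t , L′ , R′ , k₁ + k₂)
  afterCheck false t L R = (suc t , L , R , 0)

  mutual
    data Run : ℕ → Maybe Elem → List Elem → List Elem → ℕ → Set (a ⊔ ℓ) where
      small : ∀ {t pr xs} → length xs ≤ c →
              Run t pr xs (Data.Product.proj₁ (insertionSort xs))
                          (suc (Data.Product.proj₂ (insertionSort xs)))
      heap  : ∀ {pr xs} → c < length xs →
              Run zero pr xs (Data.Product.proj₁ (heapSort xs))
                             (suc (Data.Product.proj₂ (heapSort xs)))
      step  : ∀ {t₀ pr x xs kd ys k} →
              c < length (x ∷ xs) →
              let (q , rest , k₁) = selectPivot x xs
                  (L , R , noMoves , k₂) = partitionBy kd q rest
                  m = length (x ∷ xs)
                  bad = lessThanPTimes p (length L ⊓ length R) m
                  (t′ , L′ , R′ , k₃) = afterCheck bad t₀ L R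
              in
              KindOf pr q kd →
              Finish t′ pr q kd (isRight kd ∧ not bad ∧ noMoves) L′ R′ ys k →
              Run (suc t₀) pr (x ∷ xs) ys (suc (k₁ + k₂ + k₃ + k))

    -- steps (6) and (7); the Bool says whether step (6) applies
    data Finish (t : ℕ) (pr : Maybe Elem) (q : Elem)
         : Kind → Bool → List Elem → List Elem → List Elem → ℕ → Set (a ⊔ ℓ) where
      recLeft   : ∀ {b L R R′ k} → Run t (just q) R R′ k →
                  Finish t pr q left b L R (L ++ q ∷ R′) k
      recRight  : ∀ {L R L′ R′ k₁ k₂} →
                  Run t pr L L′ k₁ → Run t (just q) R R′ k₂ →
                  Finish t pr q right false L R (L′ ++ q ∷ R′) (k₁ + k₂)
      bothDone  : ∀ {L R L₁ R₁ k₁ k₂} →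
                  partialInsertionSort L ≡ (L₁ , true , k₁) →
                  partialInsertionSort R ≡ (R₁ , true , k₂) →
                  Finish t pr q right true L R (L₁ ++ q ∷ R₁) (k₁ + k₂)
      leftAbort : ∀ {L R L₁ k₁ ys k} →
                  partialInsertionSort L ≡ (L₁ , false , k₁) →
                  Finish t pr q right false L₁ R ys k →
                  Finish t pr q right true L R ys (k₁ + k)
      rightAbort : ∀ {L R L₁ R₁ k₁ k₂ ys k} →
                  partialInsertionSort L ≡ (L₁ , true , k₁) →
                  partialInsertionSort R ≡ (R₁ , false , k₂) →
                  Finish t pr q right false L₁ R₁ ys k →
                  Finish t pr q right true L R ys (k₁ + k₂ + k)

  TopRun : List Elem → List Elem → ℕ → Set (a ⊔ ℓ)
  TopRun xs ys k = Run ⌊log₂ length xs ⌋ nothing xs ys k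

{-# OPTIONS --safe #-}
module Submission where

-- Fix a positive rational q < p and let 1 + e be its denominator.  A good
-- partition of m elements leaves two parts of size at least q m ≥ m / (1 + e),
-- so each part x has (1 + e) x ≤ e m, and since ((1 + e) / e) ^ (1 + e) ≥ 2
-- (Bernoulli) the quantity ⌊log₂ (x ^ (1 + e))⌋ drops by at least one; a bad
-- partition decrements the counter t instead.  Hence t + ⌊log₂ (m ^ (1 + e))⌋
-- strictly decreases from a call to its recursive calls, and a call on m
-- elements with counter t costs at most  α m (t + ⌊log₂ (m ^ (1 + e))⌋) + β (2m + 1):
-- the linear work of a call is paid for by the drop of the potential on its
-- two parts, and its constant work by the β left over since the part sizes add
-- up to m − 1.  At the top, t = ⌊log₂ n⌋ and ⌊log₂ (n ^ (1 + e))⌋ ≤ (1 + e)(1 + ⌊log₂ n⌋).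

open import Defs
open import Data.Bool using (true; false; _∧_; not)
open import Data.Nat hiding (_/_)
open import Data.Nat.Properties
open import Data.Nat.Logarithm
open import Data.Nat.Tactic.RingSolver using (solve-∀)
open import Data.Integer as ℤ using (+_; +0; +[1+_]; -[1+_])
import Data.Integer.Properties as ℤ
open import Data.Rational as ℚ using (ℚ; mkℚ; _/_; ↧ₙ_; 0ℚ)
import Data.Rational.Properties as ℚ
import Data.Rational.Unnormalised as ℚᵘ
import Data.Rational.Unnormalised.Properties as ℚᵘ
open import Data.List using (List; []; _∷_; length)
open import Data.List.Properties using (length-++)
open import Data.List.Relation.Binary.Permutation.Propositional using (_↭_)
open import Data.List.Relation.Binary.Permutation.Propositional.Properties using (↭-length)
open import Data.Maybe using (just; nothing)
open import Data.Product using (_×_; _,_; ∃; ∃₂; proj₁; proj₂)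
open import Data.Empty using (⊥-elim)
open import Relation.Binary.PropositionalEquality
open import Relation.Nullary using (yes; no)

-- A positive rational is at least 1 / (its denominator).
↧q*x<1+m⇒x/1+m<q : ∀ (q : ℚ) → 0ℚ ℚ.< q → ∀ x m → ↧ₙ q * x < suc m → + x / suc m ℚ.< q
↧q*x<1+m⇒x/1+m<q (mkℚ +[1+ a ] b _) _ x m b*x<1+m = ℚ.toℚᵘ-cancel-<
  (ℚᵘ.≤-<-trans (ℚᵘ.≤-reflexive (ℚ.toℚᵘ-fromℚᵘ (ℚᵘ.mkℚᵘ (+ x) m)))
    (ℚᵘ.*<* (subst₂ ℤ._<_ (ℤ.pos-* x (suc b)) (ℤ.pos-* (suc a) (suc m))
      (ℤ.+<+ (<-≤-trans (subst (_< suc m) (*-comm (suc b) x) b*x<1+m)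
                        (m≤n*m (suc m) (suc a)))))))
↧q*x<1+m⇒x/1+m<q (mkℚ +0 _ _)        (ℚ.*<* (ℤ.+<+ ())) _ _ _
↧q*x<1+m⇒x/1+m<q (mkℚ -[1+ _ ] _ _) (ℚ.*<* ())         _ _ _

lessThanPTimes≡false⇒1+m≤↧q*k : ∀ p (q : ℚ) → 0ℚ ℚ.< q → RealIn01.below p q ≡ true →
                                ∀ k m → lessThanPTimes p k (suc m) ≡ false → suc m ≤ ↧ₙ q * k
lessThanPTimes≡false⇒1+m≤↧q*k p q 0<q q<p k m notBelow with ↧ₙ q * k <? suc m
... | no  ↧q*k≮1+m = ≮⇒≥ ↧q*k≮1+m
... | yes ↧q*k<1+m with trans (sym notBelow)
                                (RealIn01.downward p (↧q*x<1+m⇒x/1+m<q q 0<q k m ↧q*k<1+m) q<p)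
...   | ()

^-distribʳ-* : ∀ m n o → (m * n) ^ o ≡ m ^ o * n ^ o
^-distribʳ-* m n zero    = refl
^-distribʳ-* m n (suc o) = begin
  m * n * (m * n) ^ o     ≡⟨ cong (m * n *_) (^-distribʳ-* m n o) ⟩
  m * n * (m ^ o * n ^ o) ≡⟨ interchange m n (m ^ o) (n ^ o) ⟩
  m * m ^ o * (n * n ^ o) ∎
  where
  open ≡-Reasoning
  interchange : ∀ a b x y → a * b * (x * y) ≡ a * x * (b * y)
  interchange = solve-∀

-- Bernoulli's inequality (1 + 1/e)^k ≥ 1 + k/e, cleared of denominators.
bernoulli : ∀ e k → e ^ k * (e + k) ≤ suc e ^ k * e
bernoulli e zero    = ≤-reflexive (+-identityʳ _)
bernoulli e (suc k) = begin
  e * e ^ k * (e + suc k)   ≡⟨ solve₁ e k (e ^ k) ⟩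
  e ^ k * (e * (e + suc k)) ≤⟨ *-monoʳ-≤ (e ^ k) (e*[e+1+k]≤[e+k]*[1+e] e k) ⟩
  e ^ k * ((e + k) * suc e) ≡⟨ solve₂ e k (e ^ k) ⟩
  e ^ k * (e + k) * suc e   ≤⟨ *-monoˡ-≤ (suc e) (bernoulli e k) ⟩
  suc e ^ k * e * suc e     ≡⟨ solve₃ e (suc e ^ k) ⟩
  suc e * suc e ^ k * e     ∎
  where
  open ≤-Reasoning
  solve₁ : ∀ e k x → e * x * (e + suc k) ≡ x * (e * (e + suc k))
  solve₁ = solve-∀
  solve₂ : ∀ e k x → x * ((e + k) * suc e) ≡ x * (e + k) * suc e
  solve₂ = solve-∀
  solve₃ : ∀ e y → y * e * suc e ≡ suc e * y * e
  solve₃ = solve-∀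
  e*[e+1+k]≤[e+k]*[1+e] : ∀ e k → e * (e + suc k) ≤ (e + k) * suc e
  e*[e+1+k]≤[e+k]*[1+e] e k = begin
    e * (e + suc k)       ≡⟨ solve₄ e k ⟩
    e * e + e * k + e     ≤⟨ m≤m+n _ k ⟩
    e * e + e * k + e + k ≡⟨ solve₅ e k ⟩
    (e + k) * suc e       ∎
    where
    solve₄ : ∀ e k → e * (e + suc k) ≡ e * e + e * k + e
    solve₄ = solve-∀
    solve₅ : ∀ e k → e * e + e * k + e + k ≡ (e + k) * suc e
    solve₅ = solve-∀

2*e^[1+e]≤[1+e]^[1+e] : ∀ e → 2 * e ^ suc e ≤ suc e ^ suc e
2*e^[1+e]≤[1+e]^[1+e] zero       = z≤n
2*e^[1+e]≤[1+e]^[1+e] e@(suc _) = *-cancelʳ-≤ (2 * e ^ suc e) (suc e ^ suc e) e (begin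
  2 * e ^ suc e * e       ≡⟨ solve e (e ^ suc e) ⟩
  e ^ suc e * (e + e)     ≤⟨ *-monoʳ-≤ (e ^ suc e) (+-monoʳ-≤ e (n≤1+n e)) ⟩
  e ^ suc e * (e + suc e) ≤⟨ bernoulli e (suc e) ⟩
  suc e ^ suc e * e       ∎)
  where
  open ≤-Reasoning
  solve : ∀ e y → 2 * y * e ≡ y * (e + e)
  solve = solve-∀

m≤m^[1+n] : ∀ m n → m ≤ m ^ suc n
m≤m^[1+n] zero      n = z≤n
m≤m^[1+n] m@(suc _) n = m≤m*n m (m ^ n) {{m^n≢0 m n}}

⌊log₂[x^d]⌋<⌊log₂[m^d]⌋ : ∀ e x m → suc e * x ≤ e * m → 2 ≤ m →
                          ⌊log₂ (x ^ suc e) ⌋ < ⌊log₂ (m ^ suc e) ⌋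
⌊log₂[x^d]⌋<⌊log₂[m^d]⌋ e zero m _ 2≤m = ⌊log₂⌋-mono-≤ (≤-trans 2≤m (m≤m^[1+n] m e))
⌊log₂[x^d]⌋<⌊log₂[m^d]⌋ e x@(suc _) m d*x≤e*m _ = begin
  suc ⌊log₂ (x ^ d) ⌋ ≡⟨ ⌊log₂[2*b]⌋≡1+⌊log₂b⌋ (x ^ d) {{m^n≢0 x d}} ⟨
  ⌊log₂ (2 * x ^ d) ⌋ ≤⟨ ⌊log₂⌋-mono-≤ 2*x^d≤m^d ⟩
  ⌊log₂ (m ^ d) ⌋     ∎
  where
  d = suc e
  open ≤-Reasoning
  2*x^d≤m^d : 2 * x ^ d ≤ m ^ d
  2*x^d≤m^d = *-cancelˡ-≤ (d ^ d) {{m^n≢0 d d}} (begin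
    d ^ d * (2 * x ^ d) ≡⟨ solve (d ^ d) (x ^ d) ⟩
    2 * (d ^ d * x ^ d) ≡⟨ cong (2 *_) (^-distribʳ-* d x d) ⟨
    2 * (d * x) ^ d     ≤⟨ *-monoʳ-≤ 2 (^-monoˡ-≤ d d*x≤e*m) ⟩
    2 * (e * m) ^ d     ≡⟨ cong (2 *_) (^-distribʳ-* e m d) ⟩
    2 * (e ^ d * m ^ d) ≡⟨ *-assoc 2 (e ^ d) (m ^ d) ⟨
    2 * e ^ d * m ^ d   ≤⟨ *-monoˡ-≤ (m ^ d) (2*e^[1+e]≤[1+e]^[1+e] e) ⟩
    d ^ d * m ^ d       ∎)
    where
    solve : ∀ a b → a * (2 * b) ≡ 2 * (a * b)
    solve = solve-∀

n<2^[1+⌊log₂n⌋] : ∀ n → n < 2 ^ suc ⌊log₂ n ⌋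
n<2^[1+⌊log₂n⌋] n = ≰⇒> λ 2^[1+⌊log₂n⌋]≤n → 1+n≰n (begin
  suc ⌊log₂ n ⌋               ≡⟨ ⌊log₂[2^n]⌋≡n (suc ⌊log₂ n ⌋) ⟨
  ⌊log₂ (2 ^ suc ⌊log₂ n ⌋) ⌋ ≤⟨ ⌊log₂⌋-mono-≤ 2^[1+⌊log₂n⌋]≤n ⟩
  ⌊log₂ n ⌋                   ∎)
  where open ≤-Reasoning

⌊log₂[n^d]⌋≤[1+⌊log₂n⌋]*d : ∀ n d → ⌊log₂ (n ^ d) ⌋ ≤ suc ⌊log₂ n ⌋ * d
⌊log₂[n^d]⌋≤[1+⌊log₂n⌋]*d n d = begin
  ⌊log₂ (n ^ d) ⌋                   ≤⟨ ⌊log₂⌋-mono-≤ (^-monoˡ-≤ d (<⇒≤ (n<2^[1+⌊log₂n⌋] n))) ⟩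
  ⌊log₂ ((2 ^ suc ⌊log₂ n ⌋) ^ d) ⌋ ≡⟨ cong ⌊log₂_⌋ (^-*-assoc 2 (suc ⌊log₂ n ⌋) d) ⟩
  ⌊log₂ (2 ^ (suc ⌊log₂ n ⌋ * d)) ⌋ ≡⟨ ⌊log₂[2^n]⌋≡n _ ⟩
  suc ⌊log₂ n ⌋ * d                 ∎
  where open ≤-Reasoning

module Budget (κ K c e : ℕ) where

  lg : ℕ → ℕ
  lg m = ⌊log₂ (m ^ suc e) ⌋

  lg-mono : ∀ {x m} → x ≤ m → lg x ≤ lg m
  lg-mono x≤m = ⌊log₂⌋-mono-≤ (^-monoˡ-≤ (suc e) x≤m)

  W : ℕ
  W = 6 + K + K + c

  α β : ℕ
  α = κ + κ
  β = suc (κ * W)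

  budget : ℕ → ℕ → ℕ
  budget t m = α * (m * (t + lg m)) + β * (m + m + 1)

  partialSortsCost : ℕ → ℕ → ℕ
  partialSortsCost a b = κ * (a + K + 1) + κ * (b + K + 1)

  κ<β : κ < β
  κ<β = s≤s (m≤m*n κ W)

  κ*c<β : κ * c < β
  κ*c<β = s≤s (*-monoʳ-≤ κ (m≤n+m c (6 + K + K)))

  overhead≤ : ∀ {k₁ k₂ k₃ a b} → k₁ ≤ κ → k₂ ≤ κ * (a + b + 1) → k₃ ≤ κ + κ →
              suc (k₁ + k₂ + k₃) + partialSortsCost a b ≤ α * (a + b) + β
  overhead≤ {k₁} {k₂} {k₃} {a} {b} k₁≤ k₂≤ k₃≤ = begin
    suc (k₁ + k₂ + k₃) + partialSortsCost a b
      ≤⟨ +-monoˡ-≤ _ (s≤s (+-mono-≤ (+-mono-≤ k₁≤ k₂≤) k₃≤)) ⟩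
    suc (κ + κ * (a + b + 1) + (κ + κ)) + partialSortsCost a b
      ≡⟨ cong suc (solve κ K a b) ⟩
    suc (α * (a + b) + κ * (6 + K + K))
      ≤⟨ s≤s (+-monoʳ-≤ (α * (a + b)) (*-monoʳ-≤ κ (m≤m+n (6 + K + K) c))) ⟩
    suc (α * (a + b) + κ * W)
      ≡⟨ +-suc _ _ ⟨
    α * (a + b) + β ∎
    where
    open ≤-Reasoning
    solve : ∀ κ K a b → κ + κ * (a + b + 1) + (κ + κ) + (κ * (a + K + 1) + κ * (b + K + 1))
                        ≡ (κ + κ) * (a + b) + κ * (6 + K + K)
    solve = solve-∀

  β*m+β≤β*[m+m+1] : ∀ m → β * m + β ≤ β * (m + m + 1)
  β*m+β≤β*[m+m+1] m = ≤-trans (m≤m+n (β * m + β) (β * m)) (≤-reflexive (solve β m))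
    where
    solve : ∀ β m → β * m + β + β * m ≡ β * (m + m + 1)
    solve = solve-∀

  budget-small : ∀ t {m ins} → m ≤ c → ins ≤ κ * (m * m + 1) → suc ins ≤ budget t m
  budget-small t {m} {ins} m≤c ins≤ = begin
    suc ins                ≤⟨ s≤s ins≤ ⟩
    suc (κ * (m * m + 1))  ≤⟨ s≤s (*-monoʳ-≤ κ (+-monoˡ-≤ 1 (*-monoˡ-≤ m m≤c))) ⟩
    suc (κ * (c * m + 1))  ≡⟨ solve κ c m ⟩
    κ * c * m + suc κ      ≤⟨ +-mono-≤ (*-monoˡ-≤ m (<⇒≤ κ*c<β)) κ<β ⟩
    β * m + β              ≤⟨ β*m+β≤β*[m+m+1] m ⟩
    β * (m + m + 1)        ≤⟨ m≤n+m _ (α * (m * (t + lg m))) ⟩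
    budget t m             ∎
    where
    open ≤-Reasoning
    solve : ∀ κ c m → suc (κ * (c * m + 1)) ≡ κ * c * m + suc κ
    solve = solve-∀

  budget-heap : ∀ {m hs} → hs ≤ κ * (m * (⌊log₂ m ⌋ + 1) + 1) → suc hs ≤ budget 0 m
  budget-heap {m} {hs} hs≤ = begin
    suc hs                                ≤⟨ s≤s hs≤ ⟩
    suc (κ * (m * (⌊log₂ m ⌋ + 1) + 1))   ≡⟨ solve κ m ⌊log₂ m ⌋ ⟩
    κ * (m * ⌊log₂ m ⌋) + (κ * m + suc κ) ≤⟨ +-mono-≤ log-part linear-part ⟩
    α * (m * lg m) + β * (m + m + 1)      ∎
    where
    open ≤-Reasoning
    solve : ∀ κ m L → suc (κ * (m * (L + 1) + 1)) ≡ κ * (m * L) + (κ * m + suc κ)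
    solve = solve-∀
    log-part : κ * (m * ⌊log₂ m ⌋) ≤ α * (m * lg m)
    log-part = *-mono-≤ (m≤m+n κ κ) (*-monoʳ-≤ m (⌊log₂⌋-mono-≤ (m≤m^[1+n] m e)))
    linear-part : κ * m + suc κ ≤ β * (m + m + 1)
    linear-part = ≤-trans (+-mono-≤ (*-monoˡ-≤ m (<⇒≤ κ<β)) κ<β) (β*m+β≤β*[m+m+1] m)

  budget-child : ∀ {t t′ a m} → suc (t′ + lg a) ≤ t + lg m →
                 budget t′ a + α * a ≤ α * (a * (t + lg m)) + β * (a + a + 1)
  budget-child {t} {t′} {a} {m} descends = begin
    budget t′ a + α * a                                ≡⟨ solve α β a (t′ + lg a) ⟩
    α * (a * suc (t′ + lg a)) + β * (a + a + 1)        ≤⟨ +-monoˡ-≤ _ (*-monoʳ-≤ α (*-monoʳ-≤ a descends)) ⟩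
    α * (a * (t + lg m)) + β * (a + a + 1)             ∎
    where
    open ≤-Reasoning
    solve : ∀ α β a T → α * (a * T) + β * (a + a + 1) + α * a ≡ α * (a * suc T) + β * (a + a + 1)
    solve = solve-∀

  budget-step : ∀ {t t′ a b n k₁ k₂ k₃ k} → a + b ≡ n →
                k₁ ≤ κ → k₂ ≤ κ * (n + 1) → k₃ ≤ κ + κ →
                suc (t′ + lg a) ≤ t + lg (suc n) →
                suc (t′ + lg b) ≤ t + lg (suc n) →
                k ≤ partialSortsCost a b + (budget t′ a + budget t′ b) →
                suc (k₁ + k₂ + k₃ + k) ≤ budget t (suc n)
  budget-step {t} {t′} {a} {b} {k₁ = k₁} {k₂} {k₃} {k} refl k₁≤ k₂≤ k₃≤ a-descends b-descends k≤ = begin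
    suc (k₁ + k₂ + k₃) + k
      ≤⟨ +-monoʳ-≤ (suc (k₁ + k₂ + k₃)) k≤ ⟩
    suc (k₁ + k₂ + k₃) + (partialSortsCost a b + (budget t′ a + budget t′ b))
      ≡⟨ +-assoc (suc (k₁ + k₂ + k₃)) _ _ ⟨
    suc (k₁ + k₂ + k₃) + partialSortsCost a b + (budget t′ a + budget t′ b)
      ≤⟨ +-monoˡ-≤ _ (overhead≤ k₁≤ k₂≤ k₃≤) ⟩
    α * (a + b) + β + (budget t′ a + budget t′ b)
      ≡⟨ solve₁ α β a b (budget t′ a) (budget t′ b) ⟩
    (budget t′ a + α * a) + (budget t′ b + α * b) + β
      ≤⟨ +-monoˡ-≤ β (+-mono-≤ (budget-child {t} {m = suc (a + b)} a-descends)
                                     (budget-child {t} {m = suc (a + b)} b-descends)) ⟩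
    (α * (a * Y) + β * (a + a + 1)) + (α * (b * Y) + β * (b + b + 1)) + β
      ≤⟨ m≤m+n _ (α * Y) ⟩
    (α * (a * Y) + β * (a + a + 1)) + (α * (b * Y) + β * (b + b + 1)) + β + α * Y
      ≡⟨ solve₂ α β a b Y ⟩
    budget t (suc (a + b)) ∎
    where
    open ≤-Reasoning
    Y = t + lg (suc (a + b))
    solve₁ : ∀ α β a b A B → α * (a + b) + β + (A + B) ≡ (A + α * a) + (B + α * b) + β
    solve₁ = solve-∀
    solve₂ : ∀ α β a b Y →
             (α * (a * Y) + β * (a + a + 1)) + (α * (b * Y) + β * (b + b + 1)) + β + α * Y
             ≡ α * (suc (a + b) * Y) + β * (suc (a + b) + suc (a + b) + 1)
    solve₂ = solve-∀

  *-part≤ : ∀ {a b} → suc (a + b) ≤ suc e * b → suc e * a ≤ e * suc (a + b)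
  *-part≤ {a} {b} balanced = ≤-trans (<⇒≤ (+-cancelʳ-≤ (a + b) _ _ (begin
    suc (suc e * a) + (a + b)   ≡⟨ solve₁ e a b ⟩
    suc e * a + suc (a + b)     ≤⟨ +-monoʳ-≤ (suc e * a) balanced ⟩
    suc e * a + suc e * b       ≡⟨ solve₂ e a b ⟩
    e * (a + b) + (a + b)       ∎)))
    (*-monoʳ-≤ e (n≤1+n (a + b)))
    where
    open ≤-Reasoning
    solve₁ : ∀ e a b → suc (suc e * a) + (a + b) ≡ suc e * a + suc (a + b)
    solve₁ = solve-∀
    solve₂ : ∀ e a b → suc e * a + suc e * b ≡ e * (a + b) + (a + b)
    solve₂ = solve-∀

  lg-part< : ∀ {a b n} → a + b ≡ n → suc n ≤ suc e * b → 2 ≤ suc n → lg a < lg (suc n)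
  lg-part< {a} refl balanced 2≤m = ⌊log₂[x^d]⌋<⌊log₂[m^d]⌋ e a _ (*-part≤ balanced) 2≤m

  C : ℕ
  C = α * (1 + (suc e + suc e)) + β * 3

  budget-top : ∀ n → 2 ≤ n → budget ⌊log₂ n ⌋ n ≤ C * (n * ⌊log₂ n ⌋)
  budget-top n 2≤n = begin
    α * (n * (L + lg n)) + β * (n + n + 1)
      ≤⟨ +-mono-≤ (*-monoʳ-≤ α (*-monoʳ-≤ n (+-monoʳ-≤ L lg≤))) (*-monoʳ-≤ β n+n+1≤) ⟩
    α * (n * (L + (L + L) * d)) + β * (n * L + n * L + n * L)
      ≡⟨ solve α β n L d ⟩
    C * (n * L) ∎
    where
    open ≤-Reasoning
    L = ⌊log₂ n ⌋
    d = suc e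
    1≤L : 1 ≤ L
    1≤L = ⌊log₂⌋-mono-≤ 2≤n
    n≤n*L : n ≤ n * L
    n≤n*L = m≤m*n n L {{>-nonZero 1≤L}}
    lg≤ : lg n ≤ (L + L) * d
    lg≤ = ≤-trans (⌊log₂[n^d]⌋≤[1+⌊log₂n⌋]*d n d) (*-monoˡ-≤ d (+-monoˡ-≤ L 1≤L))
    n+n+1≤ : n + n + 1 ≤ n * L + n * L + n * L
    n+n+1≤ = +-mono-≤ (+-mono-≤ n≤n*L n≤n*L) (≤-trans (≤-trans (s≤s z≤n) 2≤n) n≤n*L)
    solve : ∀ α β n L d → α * (n * (L + (L + L) * d)) + β * (n * L + n * L + n * L)
            ≡ (α * (1 + (d + d)) + β * 3) * (n * L)
    solve = solve-∀

module Analysis {a ℓ} (P : PDQ a ℓ) where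
  open PDQ P
  open Algorithm P

  q₀ : ℚ
  q₀ = proj₁ (RealIn01.positive p)

  e : ℕ
  e = ℚ.ℚ.denominator-1 q₀

  open Budget κ K c e

  good⇒balanced : ∀ k m → lessThanPTimes p k (suc m) ≡ false → suc m ≤ suc e * k
  good⇒balanced = lessThanPTimes≡false⇒1+m≤↧q*k p q₀ (proj₁ (proj₂ (RealIn01.positive p)))
                                              (proj₂ (proj₂ (RealIn01.positive p)))

  selectPivot-length : ∀ x xs → length (proj₁ (proj₂ (selectPivot x xs))) ≡ length xs
  selectPivot-length x xs = suc-injective (↭-length (selectPivot-perm x xs))

  partitionBy-length : ∀ kd q ys → let (L , R , _ , _) = partitionBy kd q ys in
                       length L + length R ≡ length ys
  partitionBy-length left  q ys = trans (sym (length-++ (proj₁ (partitionLeft q ys))))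
                                        (↭-length (partitionLeft-perm q ys))
  partitionBy-length right q ys = trans (sym (length-++ (proj₁ (partitionRight q ys))))
                                        (↭-length (partitionRight-perm q ys))

  partitionBy-cost : ∀ kd q ys → let (_ , _ , _ , k) = partitionBy kd q ys in
                     k ≤ κ * (length ys + 1)
  partitionBy-cost left  = partitionLeft-cost
  partitionBy-cost right = partitionRight-cost

  afterCheck-length : ∀ bad t L R → let (_ , L′ , R′ , _) = afterCheck bad t L R in
                      length L′ + length R′ ≡ length L + length R
  afterCheck-length true  t L R = cong₂ _+_ (↭-length (badSwap-perm L)) (↭-length (badSwap-perm R))
  afterCheck-length false t L R = refl

  afterCheck-cost : ∀ bad t L R → let (_ , _ , _ , k) = afterCheck bad t L R in k ≤ κ + κ
  afterCheck-cost true  t L R = +-mono-≤ (badSwap-cost L) (badSwap-cost R)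
  afterCheck-cost false t L R = z≤n

  afterCheck-descends : ∀ bad t L R {n} → length L + length R ≡ n → 2 ≤ suc n →
    (bad ≡ false → suc n ≤ suc e * (length L ⊓ length R)) →
    let (t′ , L′ , R′ , _) = afterCheck bad t L R in
    suc (t′ + lg (length L′)) ≤ suc t + lg (suc n) ×
    suc (t′ + lg (length R′)) ≤ suc t + lg (suc n)
  afterCheck-descends true t L R refl _ _ =
    s≤s (+-monoʳ-≤ t (lg-mono (≤-trans (≤-reflexive (↭-length (badSwap-perm L)))
                                       (≤-trans (m≤m+n _ _) (n≤1+n _))))) ,
    s≤s (+-monoʳ-≤ t (lg-mono (≤-trans (≤-reflexive (↭-length (badSwap-perm R)))
                                       (≤-trans (m≤n+m _ _) (n≤1+n _)))))
  afterCheck-descends false t L R L+R≡n 2≤m balanced =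
    s≤s (+-monoʳ-< t (lg-part< L+R≡n
           (≤-trans (balanced refl) (*-monoʳ-≤ (suc e) (m⊓n≤n _ _))) 2≤m)) ,
    s≤s (+-monoʳ-< t (lg-part< (trans (+-comm (length R) (length L)) L+R≡n)
           (≤-trans (balanced refl) (*-monoʳ-≤ (suc e) (m⊓n≤m _ _))) 2≤m))

  partialInsertionSort≡⇒length : ∀ {L L₁ ok k} → partialInsertionSort L ≡ (L₁ , ok , k) →
                                 length L₁ ≡ length L
  partialInsertionSort≡⇒length {L} eq =
    ↭-length (subst (λ r → proj₁ r ↭ L) eq (partialInsertionSort-perm L))

  partialInsertionSort≡⇒cost : ∀ {L L₁ ok k} → partialInsertionSort L ≡ (L₁ , ok , k) →
                               k ≤ κ * (length L + K + 1)
  partialInsertionSort≡⇒cost {L} eq =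
    subst (λ r → proj₂ (proj₂ r) ≤ κ * (length L + K + 1)) eq (partialInsertionSort-cost L)

  c<m⇒2≤m : ∀ {m} → c < m → 2 ≤ m
  c<m⇒2≤m c<m = ≤-trans (s≤s (s≤s z≤n)) (≤-trans 3≤c (<⇒≤ c<m))

  mutual
    run-cost : ∀ {t pr xs ys k} → Run t pr xs ys k → k ≤ budget t (length xs)
    run-cost {t} {xs = xs} (small m≤c) = budget-small t m≤c (insertionSort-cost xs)
    run-cost {xs = xs} (heap _) = budget-heap {length xs} (heapSort-cost xs)
    run-cost (step {t₀} {pr} {x} {xs} {kd} c<m _ fin) =
      budget-step (trans (afterCheck-length bad t₀ L R) L+R≡n)
        (selectPivot-cost x xs)
        (subst (λ n → k₂ ≤ κ * (n + 1)) (selectPivot-length x xs) (partitionBy-cost kd q rest))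
        (afterCheck-cost bad t₀ L R)
        (proj₁ descends) (proj₂ descends)
        (finish-cost fin)
      where
      q = proj₁ (selectPivot x xs)
      rest = proj₁ (proj₂ (selectPivot x xs))
      L = proj₁ (partitionBy kd q rest)
      R = proj₁ (proj₂ (partitionBy kd q rest))
      k₂ = proj₂ (proj₂ (proj₂ (partitionBy kd q rest)))
      bad = lessThanPTimes p (length L ⊓ length R) (suc (length xs))
      L+R≡n : length L + length R ≡ length xs
      L+R≡n = trans (partitionBy-length kd q rest) (selectPivot-length x xs)
      descends = afterCheck-descends bad t₀ L R L+R≡n (c<m⇒2≤m c<m)
                   (good⇒balanced _ (length xs))

    finish-cost : ∀ {t pr q kd ok L R ys k} → Finish t pr q kd ok L R ys k →
                  k ≤ partialSortsCost (length L) (length R) + (budget t (length L) + budget t (length R))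
    finish-cost {t} {L = L} {R} (recLeft r) =
      ≤-trans (run-cost r) (≤-trans (m≤n+m _ (budget t (length L)))
                                    (m≤n+m _ (partialSortsCost (length L) (length R))))
    finish-cost {L = L} {R} (recRight r₁ r₂) =
      ≤-trans (+-mono-≤ (run-cost r₁) (run-cost r₂)) (m≤n+m _ (partialSortsCost (length L) (length R)))
    finish-cost {t} {L = L} {R} (bothDone eqL eqR) =
      ≤-trans (+-mono-≤ (partialInsertionSort≡⇒cost eqL) (partialInsertionSort≡⇒cost eqR))
              (m≤m+n _ (budget t (length L) + budget t (length R)))
    finish-cost {t} {L = L} {R} (leftAbort {k₁ = k₁} eqL (recRight {k₁ = a₁} {k₂ = a₂} r₁ r₂)) = begin
      k₁ + (a₁ + a₂)
        ≤⟨ +-mono-≤ (partialInsertionSort≡⇒cost eqL)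
                    (+-mono-≤ (subst (λ n → a₁ ≤ budget t n) (partialInsertionSort≡⇒length eqL) (run-cost r₁))
                              (run-cost r₂)) ⟩
      κ * (length L + K + 1) + (budget t (length L) + budget t (length R))
        ≤⟨ +-monoˡ-≤ (budget t (length L) + budget t (length R)) (m≤m+n (κ * (length L + K + 1)) (κ * (length R + K + 1))) ⟩
      partialSortsCost (length L) (length R) + (budget t (length L) + budget t (length R)) ∎
      where open ≤-Reasoning
    finish-cost {t} {L = L} {R} (rightAbort {k₁ = k₁} {k₂ = k₂} eqL eqR (recRight {k₁ = a₁} {k₂ = a₂} r₁ r₂)) = begin
      k₁ + k₂ + (a₁ + a₂)
        ≡⟨ +-assoc k₁ k₂ (a₁ + a₂) ⟩
      k₁ + (k₂ + (a₁ + a₂))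
        ≤⟨ +-mono-≤ (partialInsertionSort≡⇒cost eqL) (+-mono-≤ (partialInsertionSort≡⇒cost eqR)
             (+-mono-≤ (subst (λ n → a₁ ≤ budget t n) (partialInsertionSort≡⇒length eqL) (run-cost r₁))
                       (subst (λ n → a₂ ≤ budget t n) (partialInsertionSort≡⇒length eqR) (run-cost r₂)))) ⟩
      κ * (length L + K + 1) + (κ * (length R + K + 1) + (budget t (length L) + budget t (length R)))
        ≡⟨ +-assoc (κ * (length L + K + 1)) (κ * (length R + K + 1)) _ ⟨
      partialSortsCost (length L) (length R) + (budget t (length L) + budget t (length R)) ∎
      where open ≤-Reasoning

  kind-exists : ∀ pr q → ∃ (KindOf pr q)
  kind-exists nothing  q = right , usesRight (λ _ ())
  kind-exists (just b) q with b ≺? q | q ≺? b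
  ... | yes b≺q | _       = right , usesRight (λ { _ refl (b⊀q , _) → b⊀q b≺q })
  ... | no _    | yes q≺b = right , usesRight (λ { _ refl (_ , q⊀b) → q⊀b q≺b })
  ... | no b⊀q  | no q⊀b  = left , usesLeft (b⊀q , q⊀b)

  RunsUpTo : ℕ → Set _
  RunsUpTo n = ∀ t pr xs → length xs ≤ n → ∃₂ (Run t pr xs)

  finish-exists : ∀ {n} → RunsUpTo n → ∀ t pr q kd ok L R →
                  length L ≤ n → length R ≤ n → ∃₂ (Finish t pr q kd ok L R)
  finish-exists runs t pr q left _ L R _ R≤n with runs t (just q) R R≤n
  ... | _ , _ , r = _ , _ , recLeft r
  finish-exists runs t pr q right false L R L≤n R≤n with runs t pr L L≤n | runs t (just q) R R≤n
  ... | _ , _ , r₁ | _ , _ , r₂ = _ , _ , recRight r₁ r₂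
  finish-exists {n} runs t pr q right true L R L≤n R≤n with partialInsertionSort L in eqL
  ... | L₁ , false , _ with runs t pr L₁ (subst (_≤ n) (sym (partialInsertionSort≡⇒length eqL)) L≤n)
                          | runs t (just q) R R≤n
  ...   | _ , _ , r₁ | _ , _ , r₂ = _ , _ , leftAbort eqL (recRight r₁ r₂)
  finish-exists {n} runs t pr q right true L R L≤n R≤n | L₁ , true , _ with partialInsertionSort R in eqR
  ... | _  , true  , _ = _ , _ , bothDone eqL eqR
  ... | R₁ , false , _ with runs t pr L₁ (subst (_≤ n) (sym (partialInsertionSort≡⇒length eqL)) L≤n)
                          | runs t (just q) R₁ (subst (_≤ n) (sym (partialInsertionSort≡⇒length eqR)) R≤n)
  ...   | _ , _ , r₁ | _ , _ , r₂ = _ , _ , rightAbort eqL eqR (recRight r₁ r₂)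

  step-exists : ∀ {n} → RunsUpTo n → ∀ t₀ pr x xs → length xs ≤ n → c < suc (length xs) →
                ∃₂ (Run (suc t₀) pr (x ∷ xs))
  step-exists {n} runs t₀ pr x xs xs≤n c<m =
    _ , _ , step c<m (proj₂ (kind-exists pr q)) (proj₂ (proj₂ finish))
    where
    q = proj₁ (selectPivot x xs)
    rest = proj₁ (proj₂ (selectPivot x xs))
    kd = proj₁ (kind-exists pr q)
    L = proj₁ (partitionBy kd q rest)
    R = proj₁ (proj₂ (partitionBy kd q rest))
    noMoves = proj₁ (proj₂ (proj₂ (partitionBy kd q rest)))
    bad = lessThanPTimes p (length L ⊓ length R) (suc (length xs))
    checked = afterCheck bad t₀ L R
    L′ = proj₁ (proj₂ checked)
    R′ = proj₁ (proj₂ (proj₂ checked))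
    L′+R′≤n : length L′ + length R′ ≤ n
    L′+R′≤n = ≤-trans (≤-reflexive (trans (afterCheck-length bad t₀ L R)
                        (trans (partitionBy-length kd q rest) (selectPivot-length x xs)))) xs≤n
    finish = finish-exists runs (proj₁ checked) pr q kd (isRight kd ∧ not bad ∧ noMoves) L′ R′
               (≤-trans (m≤m+n _ _) L′+R′≤n) (≤-trans (m≤n+m _ _) L′+R′≤n)

  run-exists : ∀ n → RunsUpTo n
  run-exists n t pr xs _ with length xs ≤? c
  ... | yes xs≤c = _ , _ , small xs≤c
  run-exists n       zero      pr xs       _         | no xs≰c = _ , _ , heap (≰⇒> xs≰c)
  run-exists n       (suc t₀)  pr []       _         | no xs≰c = ⊥-elim (xs≰c z≤n)
  run-exists (suc n) (suc t₀)  pr (x ∷ xs) (s≤s xs≤n) | no xs≰c =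
    step-exists (run-exists n) t₀ pr x xs xs≤n (≰⇒> xs≰c)

theorem2 : ∀ {a ℓ} (P : PDQ a ℓ) →
    ∃ λ (C : ℕ) → ∀ (xs : List (PDQ.Elem P)) → 2 ≤ length xs →
      (∃₂ λ ys k → Algorithm.TopRun P xs ys k)
      × (∀ ys k → Algorithm.TopRun P xs ys k →
           k ≤ C * (length xs * ⌊log₂ length xs ⌋))
theorem2 P = C , λ xs 2≤n →
  run-exists (length xs) ⌊log₂ length xs ⌋ nothing xs ≤-refl ,
  λ ys k run → ≤-trans (run-cost run) (budget-top (length xs) 2≤n)
  where
  open Analysis P
  open Budget (PDQ.κ P) (PDQ.K P) (PDQ.c P) e
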